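{- Let $q$ be a prime power, $n$ a positive integer and $k$ a positive integer with $k\le\ln(n)$; put $\ell=\lfloor n/k\rfloor$ and $\alpha_k=\prod_{i=1}^k(1-q^{ -i})$. Let $B_1=(\mathbf{U}_1,\dots,\mathbf{U}_n)$ and $B_2=(\mathbf{V}_1,\dots,\mathbf{V}_n)$ be independent, uniformly random ordered bases of $\mathbb{F}_q^n$. Let $\mathcal{U}_1=\{\mathbf{U}_1,\dots,\mathbf{U}_k\}$ and for $j=1,\dots,\ell$ let $\mathcal{V}_j=\{\mathbf{V}_{(j-1)k+1},\dots,\mathbf{V}_{jk}\}$. For $j=1,\dots,\ell$ let $Y_j=1$ if $B_1-\mathcal{U}_1+\mathcal{V}_j$ is a basis of $\mathbb{F}_q^n$ and $Y_j=0$ otherwise. Then for every $i=1,\dots,\ell$, $$\mathbb{P}(Y_i=1\mid Y_1,\dots,Y_{i-1})\ge \alpha_k.$$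
   Context: An ordered basis of $\mathbb{F}_q^n$ is an $n$-tuple of vectors forming a basis; "uniformly random" means each ordered basis is equally likely. For a basis $B$ and sets $X\subseteq B$, $Y$, $B-X+Y$ denotes $(B\setminus X)\cup Y$ (here viewed as a set of vectors). -}

module Defs where

open import Data.Nat using (ℕ; zero; suc; _+_; _*_; _∸_; _^_; _≤_; _<ᵇ_; _/_; NonZero)
open import Data.Nat.Properties using (_!≢0)
open import Data.Nat.Primality using (Prime)
open import Data.Nat using () renaming (_! to fact)
open import Data.Fin using (Fin; toℕ)
open import Data.Fin.Properties using (all?; any?) renaming (_≟_ to _≟F_)
open import Data.Vec using (Vec; []; _∷_; tabulate; replicate; zipWith; lookup)
open import Data.Vec.Properties using (≡-dec)
open import Data.List using (List; []; _∷_; concatMap; map; length; filter; foldr; upTo; allFin)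
open import Data.Bool using (Bool; true; false; if_then_else_)
open import Data.Bool.Properties renaming (_≟_ to _≟B_)
open import Data.Product using (Σ; ∃; _×_; _,_; proj₁; proj₂)
open import Relation.Nullary using (Dec; yes; no; ¬_; _×-dec_; ⌊_⌋)
open import Relation.Binary.PropositionalEquality using (_≡_; _≢_; refl)
open import Algebra.Structures using (IsCommutativeRing)
import Data.Rational as ℚ
open import Data.Integer using (+_)

-- A finite field with exactly q elements, whose carrier is Fin q.
-- (Every finite field of order q is isomorphic to one of this form.)

record FiniteField (q : ℕ) : Set where
  field
    _+F_ _*F_ : Fin q → Fin q → Fin q
    -F_       : Fin q → Fin q
    0F 1F     : Fin q
    isCommutativeRing : IsCommutativeRing _≡_ _+F_ _*F_ -F_ 0F 1F
    0≢1       : 0F ≢ 1F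
    inverse   : ∀ x → x ≢ 0F → Σ (Fin q) (λ y → x *F y ≡ 1F)

IsPrimePower : ℕ → Set
IsPrimePower q = Σ ℕ λ p → Σ ℕ λ e → Prime p × (1 ≤ e) × (q ≡ p ^ e)

allVecs : ∀ {A : Set} → List A → (m : ℕ) → List (Vec A m)
allVecs xs zero    = [] ∷ []
allVecs xs (suc m) = concatMap (λ a → map (a ∷_) (allVecs xs m)) xs

count : ∀ {A : Set} → (A → Bool) → List A → ℕ
count p xs = length (filter (λ a → p a ≟B true) xs)

AllDec : Set → Set₁
AllDec A = (P : A → Set) → (∀ a → Dec (P a)) → Dec (∀ a → P a)

vecAll? : ∀ {A : Set} → AllDec A → (m : ℕ) → AllDec (Vec A m)
vecAll? dA zero P P? with P? []
... | yes p = yes λ { [] → p }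
... | no ¬p = no λ f → ¬p (f [])
vecAll? dA (suc m) P P?
  with dA (λ a → ∀ v → P (a ∷ v)) (λ a → vecAll? dA m (λ v → P (a ∷ v)) (λ v → P? (a ∷ v)))
... | yes f = yes λ { (a ∷ v) → f a v }
... | no ¬f = no λ g → ¬f (λ a v → g (a ∷ v))

ExDec : Set → Set₁
ExDec A = (P : A → Set) → (∀ a → Dec (P a)) → Dec (∃ P)

vecEx? : ∀ {A : Set} → ExDec A → (m : ℕ) → ExDec (Vec A m)
vecEx? dA zero P P? with P? []
... | yes p = yes ([] , p)
... | no ¬p = no λ { ([] , p) → ¬p p }
vecEx? dA (suc m) P P?
  with dA (λ a → ∃ λ v → P (a ∷ v)) (λ a → vecEx? dA m (λ v → P (a ∷ v)) (λ v → P? (a ∷ v)))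
... | yes (a , v , p) = yes (a ∷ v , p)
... | no ¬e = no λ { (a ∷ v , p) → ¬e (a , v , p) }

module LinAlg {q : ℕ} (F : FiniteField q) where
  open FiniteField F

  Vector : ℕ → Set
  Vector n = Vec (Fin q) n

  Family : ℕ → ℕ → Set
  Family m n = Vec (Vector n) m

  zeroV : ∀ {n} → Vector n
  zeroV = replicate _ 0F

  _+V_ : ∀ {n} → Vector n → Vector n → Vector n
  _+V_ = zipWith _+F_

  _•_ : ∀ {n} → Fin q → Vector n → Vector n
  c • v = Data.Vec.map (c *F_) v

  linComb : ∀ {m n} → Vec (Fin q) m → Family m n → Vector n
  linComb []       []       = zeroV
  linComb (c ∷ cs) (v ∷ vs) = (c • v) +V linComb cs vs

  LinIndep : ∀ {m n} → Family m n → Set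
  LinIndep {m} fam = (c : Vec (Fin q) m) → linComb c fam ≡ zeroV → c ≡ replicate m 0F

  Spans : ∀ {m n} → Family m n → Set
  Spans {m} {n} fam = (w : Vector n) → ∃ λ (c : Vec (Fin q) m) → linComb c fam ≡ w

  IsBasis : ∀ {m n} → Family m n → Set
  IsBasis fam = LinIndep fam × Spans fam

  private
    finAll : AllDec (Fin q)
    finAll P P? = all? P?
    finEx : ExDec (Fin q)
    finEx P P? = any? P?
    decV : ∀ {n} (u v : Vector n) → Dec (u ≡ v)
    decV = ≡-dec _≟F_

  isBasis? : ∀ {m n} (fam : Family m n) → Dec (IsBasis fam)
  isBasis? {m} {n} fam =
    vecAll? finAll m (λ c → linComb c fam ≡ zeroV → c ≡ replicate m 0F)
      (λ c → imp? (decV (linComb c fam) zeroV) (≡-dec _≟F_ c (replicate m 0F)))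
    ×-dec
    vecAll? finAll n (λ w → ∃ λ c → linComb c fam ≡ w)
      (λ w → vecEx? finEx m (λ c → linComb c fam ≡ w) (λ c → decV (linComb c fam) w))
    where
    imp? : ∀ {P Q : Set} → Dec P → Dec Q → Dec (P → Q)
    imp? _       (yes q) = yes λ _ → q
    imp? (no ¬p) _       = yes λ p → Data.Empty.⊥-elim (¬p p)
      where import Data.Empty
    imp? (yes p) (no ¬q) = no λ f → ¬q (f p)

  isBasisᵇ : ∀ {m n} → Family m n → Bool
  isBasisᵇ fam = ⌊ isBasis? fam ⌋

  allTuples : (n : ℕ) → List (Family n n)
  allTuples n = allVecs (allVecs (allFin q) n) n

  -- sample space: pairs (B₁ , B₂) of ordered bases of F_q^n;
  -- the uniform independent distribution is counting measure on it
  Pair : ℕ → Set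
  Pair n = Family n n × Family n n

  allPairs : (n : ℕ) → List (Pair n)
  allPairs n = concatMap (λ b₁ → map (b₁ ,_) (allTuples n)) (allTuples n)

  bothBases : ∀ {n} → Pair n → Bool
  bothBases (b₁ , b₂) = Data.Bool._∧_ (isBasisᵇ b₁) (isBasisᵇ b₂)

  -- 0-based lookup by a natural number (with a default out of range;
  -- only used in range below)
  at : ∀ {n m} → Family m n → ℕ → Vector n
  at [] i = zeroV
  at (v ∷ vs) zero = v
  at (v ∷ vs) (suc i) = at vs i

  -- the family (U_{k+1},…,U_n, V_{(j-1)k+1},…,V_{jk}), i.e. B₁ - 𝒰₁ + 𝒱_j
  -- (j is 1-based, 1 ≤ j ≤ ⌊n/k⌋)
  swapFamily : ∀ {n} (k j : ℕ) → Pair n → Family n n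
  swapFamily {n} k j (b₁ , b₂) = tabulate λ t →
    if toℕ t <ᵇ (n ∸ k)
      then at b₁ (k + toℕ t)
      else at b₂ ((j ∸ 1) * k + (toℕ t ∸ (n ∸ k)))

  Y : ∀ {n} (k j : ℕ) → Pair n → Bool
  Y k j ω = isBasisᵇ (swapFamily k j ω)

  -- the event {Y_1 = y_1, …, Y_{i-1} = y_{i-1}}, y given as a vector
  -- of length i-1 (position r ↦ value of Y_{r+1})
  agrees : ∀ {n} (k : ℕ) {m : ℕ} → Vec Bool m → Pair n → Bool
  agrees k {m} y ω = ⌊ all? (λ r → Y k (suc (toℕ r)) ω ≟B lookup y r) ⌋

-- α_k = ∏_{i=1}^k (1 - q^{-i}) = (∏_{i=1}^k (q^i - 1)) / q^{k(k+1)/2}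

alphaNum : ℕ → ℕ → ℕ
alphaNum q zero    = 1
alphaNum q (suc k) = alphaNum q k * (q ^ suc k ∸ 1)

alphaDen : ℕ → ℕ → ℕ
alphaDen q zero    = 1
alphaDen q (suc k) = alphaDen q k * q ^ suc k

-- k ≤ ln n  ⟺  e^k ≤ n  ⟺  every partial sum Σ_{m=0}^{N} k^m/m! ≤ n

expPartial : ℕ → ℕ → ℚ.ℚ
expPartial k N = foldr (λ m s → (((+ (k ^ m)) ℚ./ fact m) {{m !≢0}}) ℚ.+ s) ℚ.0ℚ (upTo (suc N))

LeLn : ℕ → ℕ → Set
LeLn k n = ∀ N → expPartial k N ℚ.≤ ((+ n) ℚ./ 1)

{-# OPTIONS --safe #-}
-- Fix B₁ and the vectors of B₂ that decide Y₁, …, Y_{i−1}. Given these, the rest of B₂ is a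
-- uniformly random independent extension of them, and Yᵢ = 1 exactly when B₁ − 𝒰₁ followed by
-- the first k vectors of that extension is independent. Choose those k vectors one at a time:
-- when c of them remain, the new vector is uniform outside the span ⟨X⟩ of what B₂ has so far,
-- and it has to avoid the span ⟨Z⟩ of a family of codimension c. Since
-- |⟨X⟩| |⟨Z⟩| ≤ qⁿ |⟨X⟩ ∩ ⟨Z⟩|, it fails with probability at most q⁻ᶜ, and multiplying over
-- c = k, …, 1 gives α_k.

module Submission where

open import Defs
open import Data.Nat using (ℕ; zero; suc; _+_; _*_; _∸_; _^_; _≤_; _<_; z≤n; s≤s; _<ᵇ_; _/_; NonZero)
open import Data.Nat.Properties hiding (_≟_)
open import Data.Nat.DivMod using (m/n*n≤m)
open import Data.Nat.Solver using (module +-*-Solver)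
open +-*-Solver using (solve; _:+_; _:*_; _:=_; con)
open import Data.Bool using (Bool; true; false; _∧_; _∨_; not; if_then_else_; T)
open import Data.Bool.Properties using (∧-conicalˡ; ∧-conicalʳ; ∧-identityʳ; ∧-zeroʳ)
open import Data.List using (List; []; _∷_; map; concatMap; length; _++_)
import Data.List.Base as List
import Data.List.Properties as List
open import Data.Fin using (Fin)
import Data.Fin.Base as Fin
import Data.Fin.Properties as Fin
open import Data.Vec using (Vec; []; _∷_) renaming (_++_ to _++ᵛ_)
import Data.Vec.Base as Vec
import Data.Vec.Properties as Vec
open import Data.Product using (Σ; ∃; _×_; _,_; proj₁; proj₂)
open import Data.Sum using (_⊎_; inj₁; inj₂)
open import Function using (_∘_)
open import Level using (0ℓ)
open import Algebra.Bundles using (CommutativeRing; AbelianGroup)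
import Algebra.Properties.Ring as RingProperties
import Algebra.Properties.Group as GroupProperties
import Algebra.Properties.AbelianGroup as AbelianGroupProperties
import Algebra.Properties.CommutativeSemigroup as CommutativeSemigroupProperties
open CommutativeSemigroupProperties +-commutativeSemigroup using () renaming (interchange to +-interchange)
open import Relation.Nullary using (Dec; yes; no; ¬_; ⌊_⌋; contradiction; _→-dec_)
open import Relation.Nullary.Decidable using (isYes≗does; dec-true; dec-false)
open import Relation.Binary.Definitions using (DecidableEquality)
open import Relation.Binary.PropositionalEquality

𝟙 : Bool → ℕ
𝟙 true  = 1
𝟙 false = 0

𝟙-∧ : ∀ a b → 𝟙 (a ∧ b) ≡ 𝟙 a * 𝟙 b
𝟙-∧ true  b = sym (+-identityʳ (𝟙 b))
𝟙-∧ false b = refl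

⌊⌋-true⇒ : ∀ {P : Set} (d : Dec P) → ⌊ d ⌋ ≡ true → P
⌊⌋-true⇒ (yes p) _ = p

⌊⌋-false⇒ : ∀ {P : Set} (d : Dec P) → ⌊ d ⌋ ≡ false → ¬ P
⌊⌋-false⇒ (no ¬p) _ = ¬p

⌊⌋-yes : ∀ {P : Set} (d : Dec P) → P → ⌊ d ⌋ ≡ true
⌊⌋-yes d p = trans (isYes≗does d) (dec-true d p)

⌊⌋-no : ∀ {P : Set} (d : Dec P) → ¬ P → ⌊ d ⌋ ≡ false
⌊⌋-no d ¬p = trans (isYes≗does d) (dec-false d ¬p)

⌊⌋-cong : ∀ {P Q : Set} (d : Dec P) (e : Dec Q) → (P → Q) → (Q → P) → ⌊ d ⌋ ≡ ⌊ e ⌋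
⌊⌋-cong (yes p) e f g = sym (⌊⌋-yes e (f p))
⌊⌋-cong (no ¬p) e f g = sym (⌊⌋-no e (¬p ∘ g))

∑ : ∀ {A : Set} → List A → (A → ℕ) → ℕ
∑ []       f = 0
∑ (x ∷ xs) f = f x + ∑ xs f

syntax ∑ xs (λ a → e) = ∑[ a ∈ xs ] e

module _ {A : Set} where

  ∑-cong : (xs : List A) {f g : A → ℕ} → (∀ a → f a ≡ g a) → ∑ xs f ≡ ∑ xs g
  ∑-cong []       f≗g = refl
  ∑-cong (x ∷ xs) f≗g = cong₂ _+_ (f≗g x) (∑-cong xs f≗g)

  ∑-mono : (xs : List A) {f g : A → ℕ} → (∀ a → f a ≤ g a) → ∑ xs f ≤ ∑ xs g
  ∑-mono []       f≤g = z≤n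
  ∑-mono (x ∷ xs) f≤g = +-mono-≤ (f≤g x) (∑-mono xs f≤g)

  ∑-+ : (xs : List A) (f g : A → ℕ) → ∑[ a ∈ xs ] (f a + g a) ≡ ∑ xs f + ∑ xs g
  ∑-+ []       f g = refl
  ∑-+ (x ∷ xs) f g = trans (cong (f x + g x +_) (∑-+ xs f g)) (+-interchange (f x) (g x) _ _)

  ∑-*ˡ : (xs : List A) (c : ℕ) (f : A → ℕ) → ∑[ a ∈ xs ] (c * f a) ≡ c * ∑ xs f
  ∑-*ˡ []       c f = sym (*-zeroʳ c)
  ∑-*ˡ (x ∷ xs) c f = trans (cong (c * f x +_) (∑-*ˡ xs c f)) (sym (*-distribˡ-+ c (f x) _))

  ∑-*ʳ : (xs : List A) (c : ℕ) (f : A → ℕ) → ∑[ a ∈ xs ] (f a * c) ≡ ∑ xs f * c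
  ∑-*ʳ xs c f = trans (∑-cong xs (λ a → *-comm (f a) c)) (trans (∑-*ˡ xs c f) (*-comm c _))

  ∑-const : (xs : List A) (c : ℕ) → ∑[ _ ∈ xs ] c ≡ length xs * c
  ∑-const []       c = refl
  ∑-const (x ∷ xs) c = cong (c +_) (∑-const xs c)

  length≡∑1 : (xs : List A) → length xs ≡ ∑[ _ ∈ xs ] 1
  length≡∑1 xs = sym (trans (∑-const xs 1) (*-identityʳ _))

  ∑-++ : (xs ys : List A) (f : A → ℕ) → ∑ (xs ++ ys) f ≡ ∑ xs f + ∑ ys f
  ∑-++ []       ys f = refl
  ∑-++ (x ∷ xs) ys f = trans (cong (f x +_) (∑-++ xs ys f)) (sym (+-assoc (f x) _ _))

  ∑-zero : (xs : List A) {f : A → ℕ} → (∀ a → f a ≡ 0) → ∑ xs f ≡ 0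
  ∑-zero []       f≗0 = refl
  ∑-zero (x ∷ xs) {f} f≗0 = trans (cong (_+ ∑ xs f) (f≗0 x)) (∑-zero xs f≗0)

  count≡∑𝟙 : (p : A → Bool) (xs : List A) → count p xs ≡ ∑[ a ∈ xs ] 𝟙 (p a)
  count≡∑𝟙 p []       = refl
  count≡∑𝟙 p (x ∷ xs) with p x
  ... | true  = cong suc (count≡∑𝟙 p xs)
  ... | false = count≡∑𝟙 p xs

  witness-or-∑𝟙≡0 : (p : A → Bool) (xs : List A) → (Σ A λ a → p a ≡ true) ⊎ (∑[ a ∈ xs ] 𝟙 (p a) ≡ 0)
  witness-or-∑𝟙≡0 p []       = inj₂ refl
  witness-or-∑𝟙≡0 p (x ∷ xs) with p x in eq
  ... | true  = inj₁ (x , eq)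
  ... | false = witness-or-∑𝟙≡0 p xs

∑-map : ∀ {A B : Set} (h : A → B) (xs : List A) (f : B → ℕ) → ∑ (map h xs) f ≡ ∑[ a ∈ xs ] f (h a)
∑-map h []       f = refl
∑-map h (x ∷ xs) f = cong (f (h x) +_) (∑-map h xs f)

∑-concatMap : ∀ {A B : Set} (g : A → List B) (xs : List A) (f : B → ℕ) →
              ∑ (concatMap g xs) f ≡ ∑[ a ∈ xs ] ∑ (g a) f
∑-concatMap g []       f = refl
∑-concatMap g (x ∷ xs) f = trans (∑-++ (g x) (concatMap g xs) f) (cong (∑ (g x) f +_) (∑-concatMap g xs f))

∑-comm : ∀ {A B : Set} (xs : List A) (ys : List B) (f : A → B → ℕ) →
         ∑[ a ∈ xs ] ∑[ b ∈ ys ] f a b ≡ ∑[ b ∈ ys ] ∑[ a ∈ xs ] f a b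
∑-comm []       ys f = sym (∑-zero ys (λ _ → refl))
∑-comm (x ∷ xs) ys f = trans (cong (∑ ys (f x) +_) (∑-comm xs ys f)) (sym (∑-+ ys (f x) _))

record Enumeration (A : Set) : Set where
  field
    _≟_      : DecidableEquality A
    elements : List A
    once     : ∀ x → ∑[ a ∈ elements ] 𝟙 ⌊ a ≟ x ⌋ ≡ 1

allFin-once : ∀ n (x : Fin n) → ∑[ a ∈ List.allFin n ] 𝟙 ⌊ a Fin.≟ x ⌋ ≡ 1
allFin-once (suc n) x = begin
  𝟙 ⌊ Fin.zero Fin.≟ x ⌋ + ∑ (List.tabulate Fin.suc) f
    ≡⟨ cong (λ l → 𝟙 ⌊ Fin.zero Fin.≟ x ⌋ + ∑ l f) (sym (List.map-tabulate (λ a → a) Fin.suc)) ⟩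
  𝟙 ⌊ Fin.zero Fin.≟ x ⌋ + ∑ (map Fin.suc (List.allFin n)) f
    ≡⟨ cong (𝟙 ⌊ Fin.zero Fin.≟ x ⌋ +_) (∑-map Fin.suc (List.allFin n) f) ⟩
  𝟙 ⌊ Fin.zero Fin.≟ x ⌋ + ∑[ a ∈ List.allFin n ] 𝟙 ⌊ Fin.suc a Fin.≟ x ⌋
    ≡⟨ rest x ⟩
  1 ∎
  where
  open ≡-Reasoning
  f : Fin (suc n) → ℕ
  f a = 𝟙 ⌊ a Fin.≟ x ⌋
  rest : ∀ x → 𝟙 ⌊ Fin.zero Fin.≟ x ⌋ + ∑[ a ∈ List.allFin n ] 𝟙 ⌊ Fin.suc a Fin.≟ x ⌋ ≡ 1
  rest Fin.zero    = cong suc (∑-zero (List.allFin n) (λ _ → refl))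
  rest (Fin.suc x) = trans (∑-cong (List.allFin n) (λ a → cong 𝟙 (⌊⌋-cong (Fin.suc a Fin.≟ Fin.suc x) (a Fin.≟ x) Fin.suc-injective (cong Fin.suc))))
                           (allFin-once n x)

finEnumeration : ∀ q → Enumeration (Fin q)
finEnumeration q = record { _≟_ = Fin._≟_ ; elements = List.allFin q ; once = allFin-once q }

⌊∷≟∷⌋ : ∀ {A : Set} (_≟_ : DecidableEquality A) {m} (a x : A) (v w : Vec A m) →
        ⌊ Vec.≡-dec _≟_ (a ∷ v) (x ∷ w) ⌋ ≡ ⌊ a ≟ x ⌋ ∧ ⌊ Vec.≡-dec _≟_ v w ⌋
⌊∷≟∷⌋ _≟_ a x v w with a ≟ x | Vec.≡-dec _≟_ v w
... | yes _ | yes _ = refl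
... | yes _ | no _  = refl
... | no _  | _     = refl

allVecs-once : ∀ {A : Set} (E : Enumeration A) m (x : Vec A m) →
               ∑[ a ∈ allVecs (Enumeration.elements E) m ] 𝟙 ⌊ Vec.≡-dec (Enumeration._≟_ E) a x ⌋ ≡ 1
allVecs-once E zero    []       = refl
allVecs-once E (suc m) (x ∷ xs) = begin
  ∑ (concatMap (λ a → map (a ∷_) (allVecs es m)) es) f
    ≡⟨ ∑-concatMap _ es f ⟩
  ∑[ a ∈ es ] ∑ (map (a ∷_) (allVecs es m)) f
    ≡⟨ ∑-cong es (λ a → trans (∑-map (a ∷_) (allVecs es m) f) (∑-cong (allVecs es m) (λ v → cong 𝟙 (⌊∷≟∷⌋ _≟_ a x v xs)))) ⟩
  ∑[ a ∈ es ] ∑[ v ∈ allVecs es m ] 𝟙 (⌊ a ≟ x ⌋ ∧ ⌊ Vec.≡-dec _≟_ v xs ⌋)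
    ≡⟨ ∑-cong es (λ a → ∑-cong (allVecs es m) (λ v → 𝟙-∧ ⌊ a ≟ x ⌋ _)) ⟩
  ∑[ a ∈ es ] ∑[ v ∈ allVecs es m ] (𝟙 ⌊ a ≟ x ⌋ * 𝟙 ⌊ Vec.≡-dec _≟_ v xs ⌋)
    ≡⟨ ∑-cong es (λ a → ∑-*ˡ (allVecs es m) (𝟙 ⌊ a ≟ x ⌋) _) ⟩
  ∑[ a ∈ es ] (𝟙 ⌊ a ≟ x ⌋ * ∑[ v ∈ allVecs es m ] 𝟙 ⌊ Vec.≡-dec _≟_ v xs ⌋)
    ≡⟨ ∑-cong es (λ a → trans (cong (𝟙 ⌊ a ≟ x ⌋ *_) (allVecs-once E m xs)) (*-identityʳ _)) ⟩
  ∑[ a ∈ es ] 𝟙 ⌊ a ≟ x ⌋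
    ≡⟨ Enumeration.once E x ⟩
  1 ∎
  where
  open ≡-Reasoning
  open Enumeration E using (_≟_) renaming (elements to es)
  f : Vec _ (suc m) → ℕ
  f v = 𝟙 ⌊ Vec.≡-dec _≟_ v (x ∷ xs) ⌋

vecEnumeration : ∀ {A : Set} → Enumeration A → ∀ m → Enumeration (Vec A m)
vecEnumeration E m = record
  { _≟_ = Vec.≡-dec (Enumeration._≟_ E)
  ; elements = allVecs (Enumeration.elements E) m
  ; once = allVecs-once E m }

length-allVecs : ∀ {A : Set} (xs : List A) m → length (allVecs xs m) ≡ length xs ^ m
length-allVecs xs zero    = refl
length-allVecs xs (suc m) = begin
  length (concatMap (λ a → map (a ∷_) (allVecs xs m)) xs)
    ≡⟨ length≡∑1 (concatMap (λ a → map (a ∷_) (allVecs xs m)) xs) ⟩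
  ∑ (concatMap (λ a → map (a ∷_) (allVecs xs m)) xs) (λ _ → 1)
    ≡⟨ ∑-concatMap _ xs _ ⟩
  ∑[ a ∈ xs ] ∑ (map (a ∷_) (allVecs xs m)) (λ _ → 1)
    ≡⟨ ∑-cong xs (λ a → trans (∑-map (a ∷_) (allVecs xs m) _) (sym (length≡∑1 (allVecs xs m)))) ⟩
  ∑[ _ ∈ xs ] length (allVecs xs m)
    ≡⟨ ∑-const xs _ ⟩
  length xs * length (allVecs xs m)
    ≡⟨ cong (length xs *_) (length-allVecs xs m) ⟩
  length xs * length xs ^ m ∎
  where open ≡-Reasoning

∑-allVecs-+ : ∀ {A : Set} (xs : List A) a s (f : Vec A (a + s) → ℕ) →
              ∑ (allVecs xs (a + s)) f ≡ ∑[ P ∈ allVecs xs a ] ∑[ R ∈ allVecs xs s ] f (P ++ᵛ R)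
∑-allVecs-+ xs zero    s f = sym (+-identityʳ _)
∑-allVecs-+ xs (suc a) s f = begin
  ∑ (allVecs xs (suc (a + s))) f
    ≡⟨ ∑-concatMap _ xs f ⟩
  ∑[ v ∈ xs ] ∑ (map (v ∷_) (allVecs xs (a + s))) f
    ≡⟨ ∑-cong xs (λ v → trans (∑-map (v ∷_) (allVecs xs (a + s)) f) (∑-allVecs-+ xs a s (λ W → f (v ∷ W)))) ⟩
  ∑[ v ∈ xs ] ∑[ P ∈ allVecs xs a ] ∑[ R ∈ allVecs xs s ] f (v ∷ (P ++ᵛ R))
    ≡⟨ ∑-cong xs (λ v → ∑-map (v ∷_) (allVecs xs a) _) ⟨
  ∑[ v ∈ xs ] ∑[ P ∈ map (v ∷_) (allVecs xs a) ] ∑[ R ∈ allVecs xs s ] f (P ++ᵛ R)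
    ≡⟨ ∑-concatMap _ xs _ ⟨
  ∑[ P ∈ allVecs xs (suc a) ] ∑[ R ∈ allVecs xs s ] f (P ++ᵛ R) ∎
  where open ≡-Reasoning

∑-allVecs-subst : ∀ {A : Set} (xs : List A) {M N} (e : M ≡ N) (f : Vec A N → ℕ) →
                  ∑ (allVecs xs N) f ≡ ∑[ R ∈ allVecs xs M ] f (subst (Vec A) e R)
∑-allVecs-subst xs refl f = refl

module Counting {A : Set} (E : Enumeration A) where
  open Enumeration E

  card : (A → Bool) → ℕ
  card P = ∑[ a ∈ elements ] 𝟙 (P a)

  once′ : ∀ x → ∑[ a ∈ elements ] 𝟙 ⌊ x ≟ a ⌋ ≡ 1
  once′ x = trans (∑-cong elements (λ a → cong 𝟙 (⌊⌋-cong (x ≟ a) (a ≟ x) sym sym))) (once x)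

  ∑-pick : ∀ x (g : A → ℕ) → ∑[ a ∈ elements ] (𝟙 ⌊ a ≟ x ⌋ * g a) ≡ g x
  ∑-pick x g = begin
    ∑[ a ∈ elements ] (𝟙 ⌊ a ≟ x ⌋ * g a) ≡⟨ ∑-cong elements only-x ⟩
    ∑[ a ∈ elements ] (𝟙 ⌊ a ≟ x ⌋ * g x) ≡⟨ ∑-*ʳ elements (g x) _ ⟩
    ∑[ a ∈ elements ] 𝟙 ⌊ a ≟ x ⌋ * g x   ≡⟨ cong (_* g x) (once x) ⟩
    1 * g x                                ≡⟨ *-identityˡ (g x) ⟩
    g x                                    ∎
    where
    open ≡-Reasoning
    only-x : ∀ a → 𝟙 ⌊ a ≟ x ⌋ * g a ≡ 𝟙 ⌊ a ≟ x ⌋ * g x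
    only-x a with a ≟ x
    ... | yes refl = refl
    ... | no _     = refl

  term≤∑ : ∀ x (g : A → ℕ) → g x ≤ ∑ elements g
  term≤∑ x g = subst (_≤ ∑ elements g) (∑-pick x g) (∑-mono elements ≤g)
    where
    ≤g : ∀ a → 𝟙 ⌊ a ≟ x ⌋ * g a ≤ g a
    ≤g a with ⌊ a ≟ x ⌋
    ... | true  = ≤-reflexive (+-identityʳ (g a))
    ... | false = z≤n

  card+card-not : ∀ (P : A → Bool) → card P + card (not ∘ P) ≡ length elements
  card+card-not P = trans (sym (∑-+ elements _ _)) (trans (∑-cong elements one) (sym (length≡∑1 elements)))
    where
    one : ∀ a → 𝟙 (P a) + 𝟙 (not (P a)) ≡ 1
    one a with P a
    ... | true  = refl
    ... | false = refl

  card-full : ∀ (P : A → Bool) → length elements ≤ card P → ∀ x → P x ≡ true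
  card-full P full x with P x in Px
  ... | true  = refl
  ... | false = contradiction full (<⇒≱ (begin-strict
      card P                         <⟨ m<m+n (card P) (subst (λ b → 𝟙 (not b) ≤ card (not ∘ P)) Px (term≤∑ x (λ a → 𝟙 (not (P a))))) ⟩
      card P + card (not ∘ P)        ≡⟨ card+card-not P ⟩
      length elements                ∎))
    where open ≤-Reasoning

  card-∨+card-∧ : ∀ (P Q : A → Bool) → card (λ a → P a ∨ Q a) + card (λ a → P a ∧ Q a) ≡ card P + card Q
  card-∨+card-∧ P Q = trans (sym (∑-+ elements _ _)) (trans (∑-cong elements pointwise) (∑-+ elements _ _))
    where
    pointwise : ∀ a → 𝟙 (P a ∨ Q a) + 𝟙 (P a ∧ Q a) ≡ 𝟙 (P a) + 𝟙 (Q a)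
    pointwise a with P a | Q a
    ... | true  | true  = refl
    ... | true  | false = refl
    ... | false | true  = refl
    ... | false | false = refl

  card-neither+card-∨ : ∀ (P Q : A → Bool) → card (λ a → not (P a) ∧ not (Q a)) + card (λ a → P a ∨ Q a) ≡ length elements
  card-neither+card-∨ P Q = trans (sym (∑-+ elements _ _)) (trans (∑-cong elements one) (sym (length≡∑1 elements)))
    where
    one : ∀ a → 𝟙 (not (P a) ∧ not (Q a)) + 𝟙 (P a ∨ Q a) ≡ 1
    one a with P a | Q a
    ... | true  | _     = refl
    ... | false | true  = refl
    ... | false | false = refl

module Counting₂ {A B : Set} (EA : Enumeration A) (EB : Enumeration B) where
  open Enumeration EA using () renaming (elements to as; _≟_ to _≟ᴬ_; once to onceᴬ)
  open Enumeration EB using () renaming (elements to bs; _≟_ to _≟ᴮ_)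
  module A′ = Counting EA
  module B′ = Counting EB

  fibre : (A → B) → (A → Bool) → B → ℕ
  fibre f P b = ∑[ a ∈ as ] (𝟙 (P a) * 𝟙 ⌊ f a ≟ᴮ b ⌋)

  ∑-fibre : (f : A → B) (P : A → Bool) → ∑[ b ∈ bs ] fibre f P b ≡ A′.card P
  ∑-fibre f P = begin
    ∑[ b ∈ bs ] ∑[ a ∈ as ] (𝟙 (P a) * 𝟙 ⌊ f a ≟ᴮ b ⌋) ≡⟨ ∑-comm bs as _ ⟩
    ∑[ a ∈ as ] ∑[ b ∈ bs ] (𝟙 (P a) * 𝟙 ⌊ f a ≟ᴮ b ⌋) ≡⟨ ∑-cong as (λ a → ∑-*ˡ bs (𝟙 (P a)) _) ⟩
    ∑[ a ∈ as ] (𝟙 (P a) * ∑[ b ∈ bs ] 𝟙 ⌊ f a ≟ᴮ b ⌋) ≡⟨ ∑-cong as (λ a → trans (cong (𝟙 (P a) *_) (B′.once′ (f a))) (*-identityʳ _)) ⟩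
    A′.card P                                            ∎
    where open ≡-Reasoning

  fibre≤1 : (f : A → B) (P : A → Bool) →
            (∀ a a′ → P a ≡ true → P a′ ≡ true → f a ≡ f a′ → a ≡ a′) → ∀ b → fibre f P b ≤ 1
  fibre≤1 f P f-inj b with witness-or-∑𝟙≡0 (λ a → P a ∧ ⌊ f a ≟ᴮ b ⌋) as
  ... | inj₂ empty = ≤-trans (≤-reflexive (trans (sym (∑-cong as (λ a → 𝟙-∧ (P a) _))) empty)) z≤n
  ... | inj₁ (a₀ , a₀∈) = ≤-trans (∑-mono as only-a₀) (≤-reflexive (onceᴬ a₀))
    where
    P-a₀ : P a₀ ≡ true
    P-a₀ = ∧-conicalˡ (P a₀) _ a₀∈
    fa₀≡b : f a₀ ≡ b
    fa₀≡b = ⌊⌋-true⇒ (f a₀ ≟ᴮ b) (∧-conicalʳ (P a₀) _ a₀∈)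
    only-a₀ : ∀ a → 𝟙 (P a) * 𝟙 ⌊ f a ≟ᴮ b ⌋ ≤ 𝟙 ⌊ a ≟ᴬ a₀ ⌋
    only-a₀ a with P a in Pa | f a ≟ᴮ b
    ... | false | _        = z≤n
    ... | true  | no _     = z≤n
    ... | true  | yes fa≡b = ≤-reflexive (cong 𝟙 (sym (⌊⌋-yes (a ≟ᴬ a₀) (f-inj a a₀ Pa P-a₀ (trans fa≡b (sym fa₀≡b))))))

  card-≤-injection : (f : A → B) (P : A → Bool) (Q : B → Bool) → (∀ a → P a ≡ true → Q (f a) ≡ true) →
                     (∀ a a′ → P a ≡ true → P a′ ≡ true → f a ≡ f a′ → a ≡ a′) → A′.card P ≤ B′.card Q
  card-≤-injection f P Q P⇒Qf f-inj = begin
    A′.card P                                ≡⟨ ∑-fibre f P ⟨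
    ∑[ b ∈ bs ] fibre f P b                  ≤⟨ ∑-mono bs fibre≤Q ⟩
    ∑[ b ∈ bs ] (𝟙 (Q b) * fibre f P b)      ≤⟨ ∑-mono bs (λ b → *-monoʳ-≤ (𝟙 (Q b)) (fibre≤1 f P f-inj b)) ⟩
    ∑[ b ∈ bs ] (𝟙 (Q b) * 1)                ≡⟨ ∑-cong bs (λ b → *-identityʳ _) ⟩
    B′.card Q                                ∎
    where
    open ≤-Reasoning
    fibre≤Q : ∀ b → fibre f P b ≤ 𝟙 (Q b) * fibre f P b
    fibre≤Q b with Q b in Qb
    ... | true  = ≤-reflexive (sym (+-identityʳ _))
    ... | false = ≤-reflexive (∑-zero as outside)
      where
      outside : ∀ a → 𝟙 (P a) * 𝟙 ⌊ f a ≟ᴮ b ⌋ ≡ 0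
      outside a with P a in Pa | f a ≟ᴮ b
      ... | false | _        = refl
      ... | true  | no _     = refl
      ... | true  | yes refl = contradiction (trans (sym (P⇒Qf a Pa)) Qb) λ ()

  card-≤-surjection : (f : A → B) (P : A → Bool) (Q : B → Bool) →
                      (∀ b → Q b ≡ true → Σ A λ a → P a ≡ true × f a ≡ b) → B′.card Q ≤ A′.card P
  card-≤-surjection f P Q f-onto = begin
    B′.card Q                ≤⟨ ∑-mono bs Q≤fibre ⟩
    ∑[ b ∈ bs ] fibre f P b  ≡⟨ ∑-fibre f P ⟩
    A′.card P                ∎
    where
    open ≤-Reasoning
    Q≤fibre : ∀ b → 𝟙 (Q b) ≤ fibre f P b
    Q≤fibre b with Q b in Qb
    ... | false = z≤n
    ... | true with f-onto b Qb
    ... | a₀ , Pa₀ , refl = subst (_≤ fibre f P (f a₀))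
                                  (cong₂ (λ x y → 𝟙 x * 𝟙 y) Pa₀ (⌊⌋-yes (f a₀ ≟ᴮ f a₀) refl))
                                  (A′.term≤∑ a₀ (λ a → 𝟙 (P a) * 𝟙 ⌊ f a ≟ᴮ f a₀ ⌋))

-- (p − 1)(Q − Sx) ≤ p (Q − U) for Sz = Q/p, U = Sx + Sz − I and Sx ≤ p I, with every
-- subtraction moved across an equation so that only semiring identities remain
outside-union-bound : ∀ p Q Nx Ng Sx Sz U I → p * Sz ≡ Q → Nx + Sx ≡ Q → Ng + U ≡ Q →
                      U + I ≡ Sx + Sz → Sx ≤ p * I → (p ∸ 1) * Nx ≤ p * Ng
outside-union-bound zero       Q Nx Ng Sx Sz U I _ _ _ _ _ = z≤n
outside-union-bound p@(suc p′) Q Nx Ng Sx Sz U I pSz≡Q Nx+Sx≡Q Ng+U≡Q U+I≡Sx+Sz Sx≤pI =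
  +-cancelʳ-≤ Q (p′ * Nx) (p * Ng) (begin
    p′ * Nx + Q          ≡⟨ cong (p′ * Nx +_) Nx+Sx≡Q ⟨
    p′ * Nx + (Nx + Sx)  ≡⟨ solve 3 (λ p′ Nx Sx → p′ :* Nx :+ (Nx :+ Sx) := (con 1 :+ p′) :* Nx :+ Sx) refl p′ Nx Sx ⟩
    p * Nx + Sx          ≤⟨ +-monoʳ-≤ (p * Nx) Sx≤pI ⟩
    p * Nx + p * I       ≡⟨ +-cancelʳ-≡ (p * U + p * Sx) _ _ expand ⟨
    p * Ng + Q           ∎)
  where
  open ≤-Reasoning
  expand : p * Ng + Q + (p * U + p * Sx) ≡ p * Nx + p * I + (p * U + p * Sx)
  expand = begin-equality
    p * Ng + Q + (p * U + p * Sx)      ≡⟨ solve 5 (λ p Ng Q U Sx → p :* Ng :+ Q :+ (p :* U :+ p :* Sx) := p :* (Ng :+ U) :+ Q :+ p :* Sx) refl p Ng Q U Sx ⟩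
    p * (Ng + U) + Q + p * Sx          ≡⟨ cong₂ (λ x y → p * x + y + p * Sx) Ng+U≡Q (sym pSz≡Q) ⟩
    p * Q + p * Sz + p * Sx            ≡⟨ solve 4 (λ p Q Sz Sx → p :* Q :+ p :* Sz :+ p :* Sx := p :* Q :+ p :* (Sx :+ Sz)) refl p Q Sz Sx ⟩
    p * Q + p * (Sx + Sz)              ≡⟨ cong₂ (λ x y → p * x + p * y) Nx+Sx≡Q U+I≡Sx+Sz ⟨
    p * (Nx + Sx) + p * (U + I)        ≡⟨ solve 5 (λ p Nx Sx U I → p :* (Nx :+ Sx) :+ p :* (U :+ I) := p :* Nx :+ p :* I :+ (p :* U :+ p :* Sx)) refl p Nx Sx U I ⟩
    p * Nx + p * I + (p * U + p * Sx)  ∎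

-- Vectors over a finite field

module VectorSpace {q : ℕ} (F : FiniteField q) where
  open FiniteField F
  open LinAlg F

  scalarRing : CommutativeRing 0ℓ 0ℓ
  scalarRing = record { isCommutativeRing = isCommutativeRing }

  module K where
    open CommutativeRing scalarRing public
    open RingProperties ring public using (-‿distribˡ-*)
    open GroupProperties +-group public using (⁻¹-involutive; ε⁻¹≈ε)

  vectorGroup : ℕ → AbelianGroup 0ℓ 0ℓ
  vectorGroup n = record
    { Carrier = Vector n
    ; _≈_     = _≡_
    ; _∙_     = _+V_
    ; ε       = zeroV
    ; _⁻¹     = Vec.map -F_
    ; isAbelianGroup = record
      { isGroup = record
        { isMonoid = record
          { isSemigroup = record
            { isMagma = record { isEquivalence = isEquivalence ; ∙-cong = cong₂ _+V_ }
            ; assoc   = Vec.zipWith-assoc K.+-assoc }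
          ; identity = Vec.zipWith-identityˡ K.+-identityˡ , Vec.zipWith-identityʳ K.+-identityʳ }
        ; inverse = Vec.zipWith-inverseˡ K.-‿inverseˡ , Vec.zipWith-inverseʳ K.-‿inverseʳ
        ; ⁻¹-cong = cong (Vec.map -F_) }
      ; comm = Vec.zipWith-comm K.+-comm } }

  module V {n : ℕ} where
    open AbelianGroup (vectorGroup n) public
    open AbelianGroupProperties (vectorGroup n) public
    open CommutativeSemigroupProperties commutativeSemigroup public using (interchange; x∙yz≈y∙xz)

  -V_ : ∀ {n} → Vector n → Vector n
  -V_ = V._⁻¹

  _-V_ : ∀ {n} → Vector n → Vector n → Vector n
  u -V w = u +V (-V w)

  [w-a₀]-[w-a]≡a-a₀ : ∀ {n} (w a a₀ : Vector n) → (w -V a₀) -V (w -V a) ≡ a -V a₀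
  [w-a₀]-[w-a]≡a-a₀ w a a₀ = begin
    (w -V a₀) -V (w -V a)        ≡⟨ cong ((w -V a₀) +V_) (V.⁻¹-anti-homo‿- w a) ⟩
    (w -V a₀) +V (a -V w)        ≡⟨ V.comm (w -V a₀) (a -V w) ⟩
    (a -V w) +V (w -V a₀)        ≡⟨ V.assoc a (-V w) (w -V a₀) ⟩
    a +V ((-V w) +V (w -V a₀))   ≡⟨ cong (a +V_) (V.\\-leftDividesʳ w (-V a₀)) ⟩
    a -V a₀                      ∎
    where open ≡-Reasoning

  0• : ∀ {n} (v : Vector n) → 0F • v ≡ zeroV
  0• v = trans (Vec.map-cong K.zeroˡ v) (Vec.map-const v 0F)

  •-zeroV : ∀ {n} c → c • zeroV {n} ≡ zeroV
  •-zeroV {n} c = trans (Vec.map-replicate (c *F_) 0F n) (cong (Vec.replicate n) (K.zeroʳ c))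

  1• : ∀ {n} (v : Vector n) → 1F • v ≡ v
  1• v = trans (Vec.map-cong K.*-identityˡ v) (Vec.map-id v)

  -‿• : ∀ {n} c (v : Vector n) → -V (c • v) ≡ (-F c) • v
  -‿• c v = trans (sym (Vec.map-∘ -F_ (c *F_) v)) (Vec.map-cong (K.-‿distribˡ-* c) v)

  •-assoc : ∀ {n} e d (v : Vector n) → e • (d • v) ≡ (e *F d) • v
  •-assoc e d v = trans (sym (Vec.map-∘ (e *F_) (d *F_) v)) (Vec.map-cong (λ x → sym (K.*-assoc e d x)) v)

  •-distribˡ : ∀ {n} c (u w : Vector n) → c • (u +V w) ≡ (c • u) +V (c • w)
  •-distribˡ c []      []      = refl
  •-distribˡ c (a ∷ u) (b ∷ w) = cong₂ _∷_ (K.distribˡ c a b) (•-distribˡ c u w)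

  •-distribʳ : ∀ {n} c d (v : Vector n) → (c • v) +V (d • v) ≡ (c +F d) • v
  •-distribʳ c d []      = refl
  •-distribʳ c d (x ∷ v) = cong₂ _∷_ (sym (K.distribʳ x c d)) (•-distribʳ c d v)

  linComb-+ : ∀ {m n} (c d : Vec (Fin q) m) (X : Family m n) → linComb c X +V linComb d X ≡ linComb (c +V d) X
  linComb-+ []      []      []      = V.identityˡ zeroV
  linComb-+ (a ∷ c) (b ∷ d) (v ∷ X) = trans (V.interchange (a • v) (linComb c X) (b • v) (linComb d X))
                                            (cong₂ _+V_ (•-distribʳ a b v) (linComb-+ c d X))

  linComb-- : ∀ {m n} (c : Vec (Fin q) m) (X : Family m n) → -V linComb c X ≡ linComb (-V c) X
  linComb-- []      []      = V.ε⁻¹≈ε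
  linComb-- (a ∷ c) (v ∷ X) = trans (sym (V.⁻¹-∙-comm (a • v) (linComb c X))) (cong₂ _+V_ (-‿• a v) (linComb-- c X))

  linComb-• : ∀ {m n} e (c : Vec (Fin q) m) (X : Family m n) → e • linComb c X ≡ linComb (e • c) X
  linComb-• e []      []      = •-zeroV e
  linComb-• e (a ∷ c) (v ∷ X) = trans (•-distribˡ e (a • v) (linComb c X)) (cong₂ _+V_ (•-assoc e a v) (linComb-• e c X))

  linComb-zero : ∀ {m n} (X : Family m n) → linComb zeroV X ≡ zeroV
  linComb-zero []      = refl
  linComb-zero (v ∷ X) = trans (cong₂ _+V_ (0• v) (linComb-zero X)) (V.identityˡ zeroV)

  linComb-++ : ∀ {a b n} (c : Vec (Fin q) a) (d : Vec (Fin q) b) (A : Family a n) (B : Family b n) →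
               linComb (c ++ᵛ d) (A ++ᵛ B) ≡ linComb c A +V linComb d B
  linComb-++ []      d []      B = sym (V.identityˡ _)
  linComb-++ (x ∷ c) d (v ∷ A) B = trans (cong ((x • v) +V_) (linComb-++ c d A B)) (sym (V.assoc (x • v) (linComb c A) (linComb d B)))

  replicate-+ : ∀ a b → Vec.replicate (a + b) 0F ≡ Vec.replicate a 0F ++ᵛ Vec.replicate b 0F
  replicate-+ zero    b = refl
  replicate-+ (suc a) b = cong (0F ∷_) (replicate-+ a b)

  InSpan : ∀ {m n} → Family m n → Vector n → Set
  InSpan {m} X w = ∃ λ (c : Vec (Fin q) m) → linComb c X ≡ w

  inSpan? : ∀ {m n} (X : Family m n) (w : Vector n) → Dec (InSpan X w)
  inSpan? {m} X w = vecEx? (λ P P? → Fin.any? P?) m (λ c → linComb c X ≡ w) (λ c → Vec.≡-dec Fin._≟_ (linComb c X) w)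

  inSpanᵇ : ∀ {m n} → Family m n → Vector n → Bool
  inSpanᵇ X w = ⌊ inSpan? X w ⌋

  InSpan-- : ∀ {m n} (X : Family m n) {u w} → InSpan X u → InSpan X w → InSpan X (u -V w)
  InSpan-- X (c , refl) (d , refl) = c -V d , trans (sym (linComb-+ c (-V d) X)) (cong (linComb c X +V_) (sym (linComb-- d X)))

  linIndep? : ∀ {m n} (X : Family m n) → Dec (LinIndep X)
  linIndep? {m} X = vecAll? (λ P P? → Fin.all? P?) m (λ c → linComb c X ≡ zeroV → c ≡ Vec.replicate m 0F)
    (λ c → Vec.≡-dec Fin._≟_ (linComb c X) zeroV →-dec Vec.≡-dec Fin._≟_ c (Vec.replicate m 0F))

  linIndepᵇ : ∀ {m n} → Family m n → Bool
  linIndepᵇ X = ⌊ linIndep? X ⌋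

  linComb-injective : ∀ {m n} (X : Family m n) → LinIndep X → ∀ c d → linComb c X ≡ linComb d X → c ≡ d
  linComb-injective X ind c d c≡d = V.x∙y⁻¹≈ε⇒x≈y c d (ind (c -V d) (begin
    linComb (c -V d) X              ≡⟨ linComb-+ c (-V d) X ⟨
    linComb c X +V linComb (-V d) X ≡⟨ cong (linComb c X +V_) (linComb-- d X) ⟨
    linComb c X -V linComb d X      ≡⟨ V.x≈y⇒x∙y⁻¹≈ε c≡d ⟩
    zeroV                           ∎))
    where open ≡-Reasoning

  linIndep-∷⇒∉span : ∀ {m n} (v : Vector n) (X : Family m n) → LinIndep (v ∷ X) → ¬ InSpan X v
  linIndep-∷⇒∉span v X ind (c , c·X≡v) = 0≢1 (begin
    0F           ≡⟨ K.ε⁻¹≈ε ⟨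
    -F 0F        ≡⟨ cong -F_ -1≡0 ⟨
    -F (-F 1F)   ≡⟨ K.⁻¹-involutive 1F ⟩
    1F           ∎)
    where
    open ≡-Reasoning
    -1≡0 : -F 1F ≡ 0F
    -1≡0 = Vec.∷-injectiveˡ (ind (-F 1F ∷ c) (begin
      ((-F 1F) • v) +V linComb c X ≡⟨ cong₂ _+V_ (-‿• 1F v) (sym c·X≡v) ⟨
      (-V (1F • v)) +V v           ≡⟨ cong (λ u → (-V u) +V v) (1• v) ⟩
      (-V v) +V v                  ≡⟨ V.inverseˡ v ⟩
      zeroV                        ∎))

  ∉span⇒linIndep-∷ : ∀ {m n} (v : Vector n) (X : Family m n) → LinIndep X → ¬ InSpan X v → LinIndep (v ∷ X)
  ∉span⇒linIndep-∷ v X ind v∉ (d ∷ c) d·v+c·X≡0 with d Fin.≟ 0F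
  ... | yes refl = cong (0F ∷_) (ind c (begin
    linComb c X            ≡⟨ V.identityˡ (linComb c X) ⟨
    zeroV +V linComb c X   ≡⟨ cong (_+V linComb c X) (0• v) ⟨
    (0F • v) +V linComb c X ≡⟨ d·v+c·X≡0 ⟩
    zeroV                  ∎))
    where open ≡-Reasoning
  ... | no d≢0 with inverse d d≢0
  ... | d⁻¹ , d·d⁻¹≡1 = contradiction (d⁻¹ • (-V c) , (begin
    linComb (d⁻¹ • (-V c)) X ≡⟨ linComb-• d⁻¹ (-V c) X ⟨
    d⁻¹ • linComb (-V c) X   ≡⟨ cong (d⁻¹ •_) (linComb-- c X) ⟨
    d⁻¹ • (-V linComb c X)   ≡⟨ cong (d⁻¹ •_) (V.inverseˡ-unique (d • v) (linComb c X) d·v+c·X≡0) ⟨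
    d⁻¹ • (d • v)            ≡⟨ •-assoc d⁻¹ d v ⟩
    (d⁻¹ *F d) • v           ≡⟨ cong (_• v) (trans (K.*-comm d⁻¹ d) d·d⁻¹≡1) ⟩
    1F • v                   ≡⟨ 1• v ⟩
    v                        ∎)) v∉
    where open ≡-Reasoning

  linIndep-++ˡ : ∀ {a b n} (A : Family a n) (B : Family b n) → LinIndep (A ++ᵛ B) → LinIndep A
  linIndep-++ˡ {a} {b} A B ind c c·A≡0 = Vec.++-injectiveˡ c (Vec.replicate a 0F)
    (trans (ind (c ++ᵛ zeroV) (trans (linComb-++ c zeroV A B) (trans (cong₂ _+V_ c·A≡0 (linComb-zero B)) (V.identityˡ zeroV))))
           (replicate-+ a b))

  linIndep-++ʳ : ∀ {a b n} (A : Family a n) (B : Family b n) → LinIndep (A ++ᵛ B) → LinIndep B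
  linIndep-++ʳ {a} {b} A B ind c c·B≡0 = Vec.++-injectiveʳ (Vec.replicate a 0F) (Vec.replicate a 0F)
    (trans (ind (zeroV ++ᵛ c) (trans (linComb-++ zeroV c A B) (trans (cong₂ _+V_ (linComb-zero A) c·B≡0) (V.identityˡ zeroV))))
           (replicate-+ a b))

  linIndep-++[] : ∀ {a n} (A : Family a n) → LinIndep A → LinIndep (A ++ᵛ [])
  linIndep-++[] {a} A ind c c·A≡0 with Vec.splitAt a c
  ... | c₁ , [] , refl = trans (cong (_++ᵛ []) (ind c₁ (trans (sym (V.identityʳ _)) (trans (sym (linComb-++ c₁ [] A [])) c·A≡0))))
                               (sym (replicate-+ a 0))

  linComb-++-∷ : ∀ {a b n} (c₁ : Vec (Fin q) a) d (c₂ : Vec (Fin q) b) (A : Family a n) v (B : Family b n) →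
                 linComb (c₁ ++ᵛ (d ∷ c₂)) (A ++ᵛ (v ∷ B)) ≡ linComb (d ∷ (c₁ ++ᵛ c₂)) (v ∷ (A ++ᵛ B))
  linComb-++-∷ c₁ d c₂ A v B = begin
    linComb (c₁ ++ᵛ (d ∷ c₂)) (A ++ᵛ (v ∷ B))   ≡⟨ linComb-++ c₁ (d ∷ c₂) A (v ∷ B) ⟩
    linComb c₁ A +V ((d • v) +V linComb c₂ B)  ≡⟨ V.x∙yz≈y∙xz _ _ _ ⟩
    (d • v) +V (linComb c₁ A +V linComb c₂ B)  ≡⟨ cong ((d • v) +V_) (linComb-++ c₁ c₂ A B) ⟨
    (d • v) +V linComb (c₁ ++ᵛ c₂) (A ++ᵛ B)   ∎
    where open ≡-Reasoning

  linIndep-swap⇒ : ∀ {a b n} (A : Family a n) v (B : Family b n) → LinIndep (A ++ᵛ (v ∷ B)) → LinIndep (v ∷ (A ++ᵛ B))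
  linIndep-swap⇒ {a} {b} A v B ind (d ∷ c) c·X≡0 with Vec.splitAt a c
  ... | c₁ , c₂ , refl = cong₂ _∷_ (Vec.∷-injectiveˡ tail≡0)
                                   (trans (cong₂ _++ᵛ_ (Vec.++-injectiveˡ c₁ _ c≡0) (Vec.∷-injectiveʳ tail≡0)) (sym (replicate-+ a b)))
    where
    c≡0 : c₁ ++ᵛ (d ∷ c₂) ≡ Vec.replicate a 0F ++ᵛ (0F ∷ Vec.replicate b 0F)
    c≡0 = trans (ind (c₁ ++ᵛ (d ∷ c₂)) (trans (linComb-++-∷ c₁ d c₂ A v B) c·X≡0)) (replicate-+ a (suc b))
    tail≡0 : d ∷ c₂ ≡ 0F ∷ Vec.replicate b 0F
    tail≡0 = Vec.++-injectiveʳ c₁ (Vec.replicate a 0F) c≡0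

  linIndep-swap⇐ : ∀ {a b n} (A : Family a n) v (B : Family b n) → LinIndep (v ∷ (A ++ᵛ B)) → LinIndep (A ++ᵛ (v ∷ B))
  linIndep-swap⇐ {a} {b} A v B ind c c·X≡0 with Vec.splitAt a c
  ... | c₁ , d ∷ c₂ , refl = trans (cong₂ _++ᵛ_ (Vec.++-injectiveˡ c₁ _ rest≡0) (cong₂ _∷_ (Vec.∷-injectiveˡ c≡0) (Vec.++-injectiveʳ c₁ _ rest≡0)))
                                   (sym (replicate-+ a (suc b)))
    where
    c≡0 : d ∷ (c₁ ++ᵛ c₂) ≡ 0F ∷ (Vec.replicate a 0F ++ᵛ Vec.replicate b 0F)
    c≡0 = trans (ind (d ∷ (c₁ ++ᵛ c₂)) (trans (sym (linComb-++-∷ c₁ d c₂ A v B)) c·X≡0)) (cong (0F ∷_) (replicate-+ a b))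
    rest≡0 : c₁ ++ᵛ c₂ ≡ Vec.replicate a 0F ++ᵛ Vec.replicate b 0F
    rest≡0 = Vec.∷-injectiveʳ c≡0

  linIndepᵇ-swap : ∀ {a b n} (A : Family a n) v (B : Family b n) → linIndepᵇ (A ++ᵛ (v ∷ B)) ≡ linIndepᵇ (v ∷ (A ++ᵛ B))
  linIndepᵇ-swap A v B = ⌊⌋-cong (linIndep? _) (linIndep? _) (linIndep-swap⇒ A v B) (linIndep-swap⇐ A v B)

  allVectors : ∀ n → List (Vector n)
  allVectors n = allVecs (List.allFin q) n

  module Vectors (n : ℕ) = Counting (vecEnumeration (finEnumeration q) n)
  module Vectors₂ (m n : ℕ) = Counting₂ (vecEnumeration (finEnumeration q) m) (vecEnumeration (finEnumeration q) n)

  length-allVectors : ∀ n → length (allVectors n) ≡ q ^ n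
  length-allVectors n = trans (length-allVecs (List.allFin q) n) (cong (_^ n) (List.length-tabulate (λ a → a)))

  card-all : ∀ n → Vectors.card n (λ _ → true) ≡ q ^ n
  card-all n = trans (sym (length≡∑1 (allVectors n))) (length-allVectors n)

  card-span : ∀ {m n} (X : Family m n) → LinIndep X → Vectors.card n (inSpanᵇ X) ≡ q ^ m
  card-span {m} {n} X ind = ≤-antisym
    (subst (Vectors.card n (inSpanᵇ X) ≤_) (card-all m)
      (Vectors₂.card-≤-surjection m n (λ c → linComb c X) (λ _ → true) (inSpanᵇ X)
        (λ w w∈ → let (c , c·X≡w) = ⌊⌋-true⇒ (inSpan? X w) w∈ in c , refl , c·X≡w)))
    (subst (_≤ Vectors.card n (inSpanᵇ X)) (card-all m)
      (Vectors₂.card-≤-injection m n (λ c → linComb c X) (λ _ → true) (inSpanᵇ X)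
        (λ c _ → ⌊⌋-yes (inSpan? X _) (c , refl)) (λ c c′ _ _ → linComb-injective X ind c c′)))

  linIndep⇒spans : ∀ {n} (X : Family n n) → LinIndep X → Spans X
  linIndep⇒spans {n} X ind w = ⌊⌋-true⇒ (inSpan? X w)
    (Vectors.card-full n (inSpanᵇ X) (≤-reflexive (trans (length-allVectors n) (sym (card-span X ind)))) w)

  isBasisᵇ≡linIndepᵇ : ∀ {n} (X : Family n n) → isBasisᵇ X ≡ linIndepᵇ X
  isBasisᵇ≡linIndepᵇ X = ⌊⌋-cong (isBasis? X) (linIndep? X) proj₁ (λ ind → ind , linIndep⇒spans X ind)

  card-translate : ∀ {n} (P : Vector n → Bool) a → Vectors.card n (λ w → P (w -V a)) ≡ Vectors.card n P
  card-translate {n} P a = ≤-antisym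
    (Vectors₂.card-≤-injection n n (_-V a) (λ w → P (w -V a)) P (λ _ Pw → Pw) (λ w w′ _ _ → V.∙-cancelʳ (-V a) w w′))
    (Vectors₂.card-≤-injection n n (_+V a) P (λ w → P (w -V a)) (λ w Pw → trans (cong P (V.//-rightDividesʳ a w)) Pw)
      (λ w w′ _ _ → V.∙-cancelʳ a w w′))

  -- The pairs (u , w) with u ∈ ⟨X⟩ and w - u ∈ ⟨Z⟩ number |⟨X⟩| |⟨Z⟩|; for fixed w, u ↦ u - a₀
  -- (a₀ any one of them) embeds the admissible u into ⟨X⟩ ∩ ⟨Z⟩.
  span-intersection-bound : ∀ {a b n} (X : Family a n) (Z : Family b n) →
    Vectors.card n (inSpanᵇ X) * Vectors.card n (inSpanᵇ Z) ≤ q ^ n * Vectors.card n (λ w → inSpanᵇ X w ∧ inSpanᵇ Z w)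
  span-intersection-bound {n = n} X Z = begin
    card ⟨X⟩ * card ⟨Z⟩                                          ≡⟨ ∑-*ʳ vs (card ⟨Z⟩) _ ⟨
    ∑[ u ∈ vs ] (𝟙 (⟨X⟩ u) * card ⟨Z⟩)                          ≡⟨ ∑-cong vs (λ u → cong (𝟙 (⟨X⟩ u) *_) (card-translate ⟨Z⟩ u)) ⟨
    ∑[ u ∈ vs ] (𝟙 (⟨X⟩ u) * card (λ w → ⟨Z⟩ (w -V u)))          ≡⟨ ∑-cong vs (λ u → ∑-*ˡ vs (𝟙 (⟨X⟩ u)) _) ⟨
    ∑[ u ∈ vs ] ∑[ w ∈ vs ] (𝟙 (⟨X⟩ u) * 𝟙 (⟨Z⟩ (w -V u)))      ≡⟨ ∑-comm vs vs _ ⟩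
    ∑[ w ∈ vs ] ∑[ u ∈ vs ] (𝟙 (⟨X⟩ u) * 𝟙 (⟨Z⟩ (w -V u)))      ≤⟨ ∑-mono vs fibre≤ ⟩
    ∑[ _ ∈ vs ] card ⟨X⟩∩⟨Z⟩                                    ≡⟨ ∑-const vs _ ⟩
    length vs * card ⟨X⟩∩⟨Z⟩                                    ≡⟨ cong (_* card ⟨X⟩∩⟨Z⟩) (length-allVectors n) ⟩
    q ^ n * card ⟨X⟩∩⟨Z⟩                                        ∎
    where
    open ≤-Reasoning
    open Vectors n using (card)
    vs : List (Vector n)
    vs = allVectors n
    ⟨X⟩ ⟨Z⟩ ⟨X⟩∩⟨Z⟩ : Vector n → Bool
    ⟨X⟩ = inSpanᵇ X
    ⟨Z⟩ = inSpanᵇ Z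
    ⟨X⟩∩⟨Z⟩ w = ⟨X⟩ w ∧ ⟨Z⟩ w

    fibre≤ : ∀ w → ∑[ u ∈ vs ] (𝟙 (⟨X⟩ u) * 𝟙 (⟨Z⟩ (w -V u))) ≤ card ⟨X⟩∩⟨Z⟩
    fibre≤ w with witness-or-∑𝟙≡0 (λ u → ⟨X⟩ u ∧ ⟨Z⟩ (w -V u)) vs
    ... | inj₂ none = ≤-trans (≤-reflexive (trans (sym (∑-cong vs (λ u → 𝟙-∧ (⟨X⟩ u) _))) none)) z≤n
    ... | inj₁ (a₀ , a₀∈) = ≤-trans (≤-reflexive (sym (∑-cong vs (λ u → 𝟙-∧ (⟨X⟩ u) _))))
        (Vectors₂.card-≤-injection n n (_-V a₀) (λ u → ⟨X⟩ u ∧ ⟨Z⟩ (w -V u)) ⟨X⟩∩⟨Z⟩ shifted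
          (λ u u′ _ _ → V.∙-cancelʳ (-V a₀) u u′))
      where
      inX : ∀ {u} → ⟨X⟩ u ≡ true → InSpan X u
      inX = ⌊⌋-true⇒ (inSpan? X _)
      inZ : ∀ {u} → ⟨Z⟩ u ≡ true → InSpan Z u
      inZ = ⌊⌋-true⇒ (inSpan? Z _)
      shifted : ∀ u → ⟨X⟩ u ∧ ⟨Z⟩ (w -V u) ≡ true → ⟨X⟩∩⟨Z⟩ (u -V a₀) ≡ true
      shifted u u∈ = cong₂ _∧_
        (⌊⌋-yes (inSpan? X _) (InSpan-- X (inX (∧-conicalˡ _ _ u∈)) (inX (∧-conicalˡ _ _ a₀∈))))
        (⌊⌋-yes (inSpan? Z _) (subst (InSpan Z) ([w-a₀]-[w-a]≡a-a₀ w u a₀)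
          (InSpan-- Z (inZ (∧-conicalʳ _ _ a₀∈)) (inZ (∧-conicalʳ _ _ u∈)))))

  card-∉span : ∀ {a n} (X : Family a n) → LinIndep X → Vectors.card n (not ∘ inSpanᵇ X) ≡ q ^ n ∸ q ^ a
  card-∉span {a} {n} X ind = begin
    card (not ∘ inSpanᵇ X)                                         ≡⟨ m+n∸m≡n (card (inSpanᵇ X)) _ ⟨
    card (inSpanᵇ X) + card (not ∘ inSpanᵇ X) ∸ card (inSpanᵇ X)  ≡⟨ cong₂ _∸_ (trans (card+card-not (inSpanᵇ X)) (length-allVectors n)) (card-span X ind) ⟩
    q ^ n ∸ q ^ a                                                  ∎
    where
    open ≡-Reasoning
    open Vectors n using (card; card+card-not)

  card-∉span-∉span : ∀ {a b c n} (X : Family a n) (Z : Family b n) → b + c ≡ n → LinIndep Z →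
    (q ^ c ∸ 1) * Vectors.card n (not ∘ inSpanᵇ X) ≤ q ^ c * Vectors.card n (λ v → not (inSpanᵇ X v) ∧ not (inSpanᵇ Z v))
  card-∉span-∉span {b = b} {c} {n} X Z b+c≡n indZ =
    outside-union-bound (q ^ c) (q ^ n) _ _ (card ⟨X⟩) (card ⟨Z⟩) (card (λ v → ⟨X⟩ v ∨ ⟨Z⟩ v)) (card ⟨X⟩∩⟨Z⟩)
      (begin-equality
        q ^ c * card ⟨Z⟩ ≡⟨ cong (q ^ c *_) (card-span Z indZ) ⟩
        q ^ c * q ^ b    ≡⟨ *-comm (q ^ c) (q ^ b) ⟩
        q ^ b * q ^ c    ≡⟨ ^-distribˡ-+-* q b c ⟨
        q ^ (b + c)      ≡⟨ cong (q ^_) b+c≡n ⟩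
        q ^ n            ∎)
      (trans (+-comm _ (card ⟨X⟩)) (trans (card+card-not ⟨X⟩) (length-allVectors n)))
      (trans (card-neither+card-∨ ⟨X⟩ ⟨Z⟩) (length-allVectors n))
      (card-∨+card-∧ ⟨X⟩ ⟨Z⟩)
      (*-cancelʳ-≤ (card ⟨X⟩) (q ^ c * card ⟨X⟩∩⟨Z⟩) (card ⟨Z⟩) {{card⟨Z⟩-nonZero}} (begin
        card ⟨X⟩ * card ⟨Z⟩              ≤⟨ span-intersection-bound X Z ⟩
        q ^ n * card ⟨X⟩∩⟨Z⟩             ≡⟨ cong (_* card ⟨X⟩∩⟨Z⟩) (trans (cong (q ^_) (sym b+c≡n)) (^-distribˡ-+-* q b c)) ⟩
        q ^ b * q ^ c * card ⟨X⟩∩⟨Z⟩     ≡⟨ solve 3 (λ x y z → x :* y :* z := y :* z :* x) refl (q ^ b) (q ^ c) _ ⟩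
        q ^ c * card ⟨X⟩∩⟨Z⟩ * q ^ b     ≡⟨ cong (q ^ c * card ⟨X⟩∩⟨Z⟩ *_) (card-span Z indZ) ⟨
        q ^ c * card ⟨X⟩∩⟨Z⟩ * card ⟨Z⟩  ∎))
    where
    open ≤-Reasoning
    open Vectors n using (card; card+card-not; card-neither+card-∨; card-∨+card-∧)
    ⟨X⟩ ⟨Z⟩ ⟨X⟩∩⟨Z⟩ : Vector n → Bool
    ⟨X⟩ = inSpanᵇ X
    ⟨Z⟩ = inSpanᵇ Z
    ⟨X⟩∩⟨Z⟩ v = ⟨X⟩ v ∧ ⟨Z⟩ v
    card⟨Z⟩-nonZero : NonZero (card ⟨Z⟩)
    card⟨Z⟩-nonZero = subst NonZero (sym (card-span Z indZ)) (m^n≢0 q b {{Fin.nonZeroIndex 0F}})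

  -- Independent extensions

  families : ∀ n s → List (Family s n)
  families n s = allVecs (allVectors n) s

  extensions : ∀ {a n} → Family a n → ℕ → ℕ
  extensions {n = n} X s = ∑[ R ∈ families n s ] 𝟙 (linIndepᵇ (X ++ᵛ R))

  commonExtensions : ∀ {a b n} → Family a n → Family b n → ℕ → ℕ → ℕ
  commonExtensions {n = n} X Z r t =
    ∑[ R ∈ families n (r + t) ] 𝟙 (linIndepᵇ (X ++ᵛ R) ∧ linIndepᵇ (Z ++ᵛ Vec.take r R))

  extensionCount : ℕ → ℕ → ℕ → ℕ
  extensionCount n a zero    = 1
  extensionCount n a (suc s) = (q ^ n ∸ q ^ a) * extensionCount n (suc a) s

  ∑-families-suc : ∀ n s (f : Family (suc s) n → ℕ) →
                   ∑ (families n (suc s)) f ≡ ∑[ v ∈ allVectors n ] ∑[ R ∈ families n s ] f (v ∷ R)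
  ∑-families-suc n s f = trans (∑-concatMap _ (allVectors n) f) (∑-cong (allVectors n) (λ v → ∑-map (v ∷_) (families n s) f))

  extensions-suc : ∀ {a n} (X : Family a n) s → extensions X (suc s) ≡ ∑[ v ∈ allVectors n ] extensions (v ∷ X) s
  extensions-suc {n = n} X s = trans (∑-families-suc n s _)
    (∑-cong (allVectors n) (λ v → ∑-cong (families n s) (λ R → cong 𝟙 (linIndepᵇ-swap X v R))))

  commonExtensions-suc : ∀ {a b n} (X : Family a n) (Z : Family b n) r t →
    commonExtensions X Z (suc r) t ≡ ∑[ v ∈ allVectors n ] commonExtensions (v ∷ X) (v ∷ Z) r t
  commonExtensions-suc {n = n} X Z r t = trans (∑-families-suc n (r + t) _)
    (∑-cong (allVectors n) (λ v → ∑-cong (families n (r + t))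
      (λ R → cong 𝟙 (cong₂ _∧_ (linIndepᵇ-swap X v R) (linIndepᵇ-swap Z v (Vec.take r R))))))

  extensions-dependent : ∀ {a n} (X : Family a n) s → ¬ LinIndep X → extensions X s ≡ 0
  extensions-dependent {n = n} X s dep =
    ∑-zero (families n s) (λ R → cong 𝟙 (⌊⌋-no (linIndep? (X ++ᵛ R)) (dep ∘ linIndep-++ˡ X R)))

  extensions≡extensionCount : ∀ {a n} (X : Family a n) s → LinIndep X → extensions X s ≡ extensionCount n a s
  extensions≡extensionCount X zero ind = cong (_+ 0) (cong 𝟙 (⌊⌋-yes (linIndep? (X ++ᵛ [])) (linIndep-++[] X ind)))
  extensions≡extensionCount {a} {n} X (suc s) ind = begin
    extensions X (suc s)                                                        ≡⟨ extensions-suc X s ⟩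
    ∑[ v ∈ allVectors n ] extensions (v ∷ X) s                                  ≡⟨ ∑-cong (allVectors n) extend ⟩
    ∑[ v ∈ allVectors n ] (𝟙 (not (inSpanᵇ X v)) * extensionCount n (suc a) s) ≡⟨ ∑-*ʳ (allVectors n) _ _ ⟩
    Vectors.card n (not ∘ inSpanᵇ X) * extensionCount n (suc a) s             ≡⟨ cong (_* extensionCount n (suc a) s) (card-∉span X ind) ⟩
    extensionCount n a (suc s)                                                  ∎
    where
    open ≡-Reasoning
    extend : ∀ v → extensions (v ∷ X) s ≡ 𝟙 (not (inSpanᵇ X v)) * extensionCount n (suc a) s
    extend v with inSpanᵇ X v in v∈?
    ... | true  = extensions-dependent (v ∷ X) s (λ ind′ → linIndep-∷⇒∉span v X ind′ (⌊⌋-true⇒ (inSpan? X v) v∈?))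
    ... | false = trans (extensions≡extensionCount (v ∷ X) s (∉span⇒linIndep-∷ v X ind (⌊⌋-false⇒ (inSpan? X v) v∈?)))
                        (sym (+-identityʳ _))

  alpha-extensions-bound : ∀ r t {a b n} (X : Family a n) (Z : Family b n) → b + r ≡ n → LinIndep X → LinIndep Z →
                           alphaNum q r * extensions X (r + t) ≤ alphaDen q r * commonExtensions X Z r t
  alpha-extensions-bound zero t X Z _ _ indZ = ≤-reflexive (cong (1 *_) (∑-cong (families _ t)
    (λ R → cong 𝟙 (sym (trans (cong (linIndepᵇ (X ++ᵛ R) ∧_) (⌊⌋-yes (linIndep? (Z ++ᵛ [])) (linIndep-++[] Z indZ)))
                              (∧-identityʳ _))))))
  alpha-extensions-bound (suc r) t {a} {b} {n} X Z b+r+1≡n indX indZ = begin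
    αN * (p ∸ 1) * extensions X (suc (r + t))   ≡⟨ cong (αN * (p ∸ 1) *_) (extensions≡extensionCount X (suc (r + t)) indX) ⟩
    αN * (p ∸ 1) * ((q ^ n ∸ q ^ a) * E′)        ≡⟨ cong (λ x → αN * (p ∸ 1) * (x * E′)) (card-∉span X indX) ⟨
    αN * (p ∸ 1) * (card ∉⟨X⟩ * E′)              ≡⟨ solve 4 (λ α p′ N E → α :* p′ :* (N :* E) := p′ :* N :* (α :* E)) refl αN (p ∸ 1) (card ∉⟨X⟩) E′ ⟩
    (p ∸ 1) * card ∉⟨X⟩ * (αN * E′)              ≤⟨ *-monoˡ-≤ (αN * E′) (card-∉span-∉span X Z b+r+1≡n indZ) ⟩
    p * card ∉⟨X⟩∪⟨Z⟩ * (αN * E′)                ≡⟨ *-assoc p _ _ ⟩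
    p * (card ∉⟨X⟩∪⟨Z⟩ * (αN * E′))              ≤⟨ *-monoʳ-≤ p outside-both ⟩
    p * (αD * commonExtensions X Z (suc r) t)   ≡⟨ solve 3 (λ p α C → p :* (α :* C) := α :* p :* C) refl p αD _ ⟩
    αD * p * commonExtensions X Z (suc r) t     ∎
    where
    open ≤-Reasoning
    open Vectors n using (card)
    αN αD p E′ : ℕ
    αN = alphaNum q r
    αD = alphaDen q r
    p = q ^ suc r
    E′ = extensionCount n (suc a) (r + t)
    ∉⟨X⟩ ∉⟨X⟩∪⟨Z⟩ : Vector n → Bool
    ∉⟨X⟩ = not ∘ inSpanᵇ X
    ∉⟨X⟩∪⟨Z⟩ v = not (inSpanᵇ X v) ∧ not (inSpanᵇ Z v)
    extend : ∀ v → 𝟙 (∉⟨X⟩∪⟨Z⟩ v) * (αN * E′) ≤ αD * commonExtensions (v ∷ X) (v ∷ Z) r t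
    extend v with inSpanᵇ X v in v∈X? | inSpanᵇ Z v in v∈Z?
    ... | true  | _     = z≤n
    ... | false | true  = z≤n
    ... | false | false = ≤-trans
        (≤-reflexive (trans (+-identityʳ _) (cong (αN *_) (sym (extensions≡extensionCount (v ∷ X) (r + t) indX′)))))
        (alpha-extensions-bound r t (v ∷ X) (v ∷ Z) (trans (sym (+-suc b r)) b+r+1≡n) indX′ indZ′)
      where
      indX′ : LinIndep (v ∷ X)
      indX′ = ∉span⇒linIndep-∷ v X indX (⌊⌋-false⇒ (inSpan? X v) v∈X?)
      indZ′ : LinIndep (v ∷ Z)
      indZ′ = ∉span⇒linIndep-∷ v Z indZ (⌊⌋-false⇒ (inSpan? Z v) v∈Z?)
    outside-both : card ∉⟨X⟩∪⟨Z⟩ * (αN * E′) ≤ αD * commonExtensions X Z (suc r) t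
    outside-both = begin
      card ∉⟨X⟩∪⟨Z⟩ * (αN * E′)                                           ≡⟨ ∑-*ʳ (allVectors n) _ _ ⟨
      ∑[ v ∈ allVectors n ] (𝟙 (∉⟨X⟩∪⟨Z⟩ v) * (αN * E′))                 ≤⟨ ∑-mono (allVectors n) extend ⟩
      ∑[ v ∈ allVectors n ] (αD * commonExtensions (v ∷ X) (v ∷ Z) r t)  ≡⟨ ∑-*ˡ (allVectors n) αD _ ⟩
      αD * ∑[ v ∈ allVectors n ] commonExtensions (v ∷ X) (v ∷ Z) r t    ≡⟨ cong (αD *_) (commonExtensions-suc X Z r t) ⟨
      αD * commonExtensions X Z (suc r) t                                 ∎

  at-++ˡ : ∀ {a b n} (A : Family a n) (B : Family b n) j → j < a → at (A ++ᵛ B) j ≡ at A j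
  at-++ˡ (v ∷ A) B zero    _         = refl
  at-++ˡ (v ∷ A) B (suc j) (s≤s j<a) = at-++ˡ A B j j<a

  at-++ʳ : ∀ {a b n} (A : Family a n) (B : Family b n) j → at (A ++ᵛ B) (a + j) ≡ at B j
  at-++ʳ []      B j = refl
  at-++ʳ (v ∷ A) B j = at-++ʳ A B j

  at-subst : ∀ {a b n} (e : a ≡ b) (X : Family a n) j → at (subst (Vec (Vector n)) e X) j ≡ at X j
  at-subst refl X j = refl

  at-tabulate : ∀ {N n} (f : Fin N → Vector n) j (j<N : j < N) → at (Vec.tabulate f) j ≡ f (Fin.fromℕ< j<N)
  at-tabulate {suc N} f zero    _         = refl
  at-tabulate {suc N} f (suc j) (s≤s j<N) = at-tabulate (f ∘ Fin.suc) j j<N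

  at-take : ∀ {r t n} (R : Family (r + t) n) j → j < r → at (Vec.take r R) j ≡ at R j
  at-take {suc r} (v ∷ R) zero    _         = refl
  at-take {suc r} (v ∷ R) (suc j) (s≤s j<r) = at-take {r} R j j<r

  at-drop : ∀ {r t n} (R : Family (r + t) n) j → at (Vec.drop r R) j ≡ at R (r + j)
  at-drop {r} R j = trans (sym (at-++ʳ (Vec.take r R) (Vec.drop r R) j)) (cong (λ X → at X (r + j)) (Vec.take++drop≡id r R))

  at-ext : ∀ {a n} (X Y : Family a n) → (∀ j → j < a → at X j ≡ at Y j) → X ≡ Y
  at-ext []      []      _  = refl
  at-ext (v ∷ X) (w ∷ Y) eq = cong₂ _∷_ (eq 0 (s≤s z≤n)) (at-ext X Y (λ j j<a → eq (suc j) (s≤s j<a)))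

  at-swapFamily : ∀ {n} k j (ω : Pair n) j′ → j′ < n →
    at (swapFamily k j ω) j′ ≡ (if j′ <ᵇ n ∸ k then at (proj₁ ω) (k + j′) else at (proj₂ ω) ((j ∸ 1) * k + (j′ ∸ (n ∸ k))))
  at-swapFamily {n} k j (b₁ , b₂) j′ j′<n = trans (at-tabulate _ j′ j′<n)
    (cong (λ x → if x <ᵇ n ∸ k then at b₁ (k + x) else at b₂ ((j ∸ 1) * k + (x ∸ (n ∸ k)))) (Fin.toℕ-fromℕ< j′<n))

  linIndepᵇ-subst : ∀ {a b n} (e : a ≡ b) (X : Family a n) → linIndepᵇ (subst (Vec (Vector n)) e X) ≡ linIndepᵇ X
  linIndepᵇ-subst refl X = refl

  linIndep-subst : ∀ {a b n} (e : a ≡ b) (X : Family a n) → LinIndep X → LinIndep (subst (Vec (Vector n)) e X)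
  linIndep-subst refl X ind = ind

-- The experiment

-- Here i′ = i − 1. B₂ is split as P ++ R, where P = 𝒱₁ ∪ … ∪ 𝒱_{i−1} decides Y₁ … Y_{i−1} and R
-- starts with 𝒱ᵢ; rest B₁ = (U_{k+1}, …, U_n) is B₁ − 𝒰₁.
module Experiment {q : ℕ} (F : FiniteField q) (n k i′ : ℕ) (y : Vec Bool i′) (i*k≤n : suc i′ * k ≤ n) where
  open FiniteField F
  open LinAlg F
  open VectorSpace F

  m t u : ℕ
  m = i′ * k
  t = n ∸ (m + k)
  u = n ∸ k

  m+k≤n : m + k ≤ n
  m+k≤n = subst (_≤ n) (+-comm k m) i*k≤n

  split : m + (k + t) ≡ n
  split = trans (sym (+-assoc m k t)) (m+[n∸m]≡n m+k≤n)

  u+k≡n : u + k ≡ n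
  u+k≡n = m∸n+n≡m (≤-trans (m≤n+m k m) m+k≤n)

  join : Family m n → Family (k + t) n → Family n n
  join P R = subst (Vec (Vector n)) split (P ++ᵛ R)

  n≡k+u : n ≡ k + u
  n≡k+u = trans (sym u+k≡n) (+-comm u k)

  rest : Family n n → Family u n
  rest b₁ = Vec.drop k (subst (Vec (Vector n)) n≡k+u b₁)

  at-rest : ∀ b₁ j → at (rest b₁) j ≡ at b₁ (k + j)
  at-rest b₁ j = trans (at-drop {k} _ j) (at-subst n≡k+u b₁ (k + j))

  linIndep-rest : ∀ b₁ → IsBasis b₁ → LinIndep (rest b₁)
  linIndep-rest b₁ (ind , _) = linIndep-++ʳ (Vec.take k b₁′) (Vec.drop k b₁′)
    (subst LinIndep (sym (Vec.take++drop≡id k b₁′)) (linIndep-subst _ b₁ ind))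
    where b₁′ = subst (Vec (Vector n)) n≡k+u b₁

  window : ∀ {j} → (j <ᵇ u) ≡ false → j < n → u ≤ j × j ∸ u < k
  window {j} j≮u j<n = u≤j , subst (j ∸ u <_) (m+n∸m≡n u k) (∸-monoˡ-< (subst (j <_) (sym u+k≡n) j<n) u≤j)
    where
    u≤j : u ≤ j
    u≤j = ≮⇒≥ (λ j<u → subst T j≮u (<⇒<ᵇ j<u))

  swapFamily-join-history : ∀ b₁ P R R′ (r : Fin i′) →
    swapFamily k (suc (Fin.toℕ r)) (b₁ , join P R) ≡ swapFamily k (suc (Fin.toℕ r)) (b₁ , join P R′)
  swapFamily-join-history b₁ P R R′ r = at-ext _ _ λ j j<n →
    trans (at-swapFamily k (suc (Fin.toℕ r)) (b₁ , join P R) j j<n)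
          (trans (same j j<n) (sym (at-swapFamily k (suc (Fin.toℕ r)) (b₁ , join P R′) j j<n)))
    where
    same : ∀ j → j < n → (if j <ᵇ u then at b₁ (k + j) else at (join P R) (Fin.toℕ r * k + (j ∸ u)))
                       ≡ (if j <ᵇ u then at b₁ (k + j) else at (join P R′) (Fin.toℕ r * k + (j ∸ u)))
    same j j<n with j <ᵇ u in j<u?
    ... | true  = refl
    ... | false = begin
      at (join P R) ι      ≡⟨ at-subst split (P ++ᵛ R) ι ⟩
      at (P ++ᵛ R) ι       ≡⟨ at-++ˡ P R ι ι<m ⟩
      at P ι               ≡⟨ at-++ˡ P R′ ι ι<m ⟨
      at (P ++ᵛ R′) ι      ≡⟨ at-subst split (P ++ᵛ R′) ι ⟨
      at (join P R′) ι     ∎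
      where
      open ≡-Reasoning
      ι : ℕ
      ι = Fin.toℕ r * k + (j ∸ u)
      ι<m : ι < m
      ι<m = <-≤-trans (+-monoʳ-< (Fin.toℕ r * k) (proj₂ (window j<u? j<n)))
                      (≤-trans (≤-reflexive (+-comm (Fin.toℕ r * k) k)) (*-monoˡ-≤ k (Fin.toℕ<n r)))

  agrees-join : ∀ b₁ P R R′ → agrees k y (b₁ , join P R) ≡ agrees k y (b₁ , join P R′)
  agrees-join b₁ P R R′ = ⌊⌋-cong (Fin.all? _) (Fin.all? _)
    (λ h r → trans (cong isBasisᵇ (swapFamily-join-history b₁ P R′ R r)) (h r))
    (λ h r → trans (cong isBasisᵇ (swapFamily-join-history b₁ P R R′ r)) (h r))

  swapFamily-join : ∀ b₁ P R → swapFamily k (suc i′) (b₁ , join P R) ≡ subst (Vec (Vector n)) u+k≡n (rest b₁ ++ᵛ Vec.take k R)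
  swapFamily-join b₁ P R = at-ext _ _ λ j j<n →
    trans (at-swapFamily k (suc i′) (b₁ , join P R) j j<n) (trans (entry j j<n) (sym (at-subst u+k≡n (rest b₁ ++ᵛ Vec.take k R) j)))
    where
    entry : ∀ j → j < n → (if j <ᵇ u then at b₁ (k + j) else at (join P R) (m + (j ∸ u))) ≡ at (rest b₁ ++ᵛ Vec.take k R) j
    entry j j<n with j <ᵇ u in j<u?
    ... | true  = sym (trans (at-++ˡ (rest b₁) (Vec.take k R) j (<ᵇ⇒< j u (subst T (sym j<u?) _))) (at-rest b₁ j))
    ... | false = begin
      at (join P R) (m + s)                      ≡⟨ at-subst split (P ++ᵛ R) (m + s) ⟩
      at (P ++ᵛ R) (m + s)                       ≡⟨ at-++ʳ P R s ⟩
      at R s                                     ≡⟨ at-take {k} R s s<k ⟨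
      at (Vec.take k R) s                        ≡⟨ at-++ʳ (rest b₁) (Vec.take k R) s ⟨
      at (rest b₁ ++ᵛ Vec.take k R) (u + s)      ≡⟨ cong (at (rest b₁ ++ᵛ Vec.take k R)) (m+[n∸m]≡n u≤j) ⟩
      at (rest b₁ ++ᵛ Vec.take k R) j            ∎
      where
      open ≡-Reasoning
      s : ℕ
      s = j ∸ u
      u≤j : u ≤ j
      u≤j = proj₁ (window j<u? j<n)
      s<k : s < k
      s<k = proj₂ (window j<u? j<n)

  Y-join : ∀ b₁ P R → Y k (suc i′) (b₁ , join P R) ≡ linIndepᵇ (rest b₁ ++ᵛ Vec.take k R)
  Y-join b₁ P R = begin
    isBasisᵇ (swapFamily k (suc i′) (b₁ , join P R))  ≡⟨ isBasisᵇ≡linIndepᵇ _ ⟩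
    linIndepᵇ (swapFamily k (suc i′) (b₁ , join P R)) ≡⟨ cong linIndepᵇ (swapFamily-join b₁ P R) ⟩
    linIndepᵇ (subst (Vec (Vector n)) u+k≡n (rest b₁ ++ᵛ Vec.take k R)) ≡⟨ linIndepᵇ-subst u+k≡n _ ⟩
    linIndepᵇ (rest b₁ ++ᵛ Vec.take k R) ∎
    where open ≡-Reasoning

  αN αD : ℕ
  αN = alphaNum q k
  αD = alphaDen q k

  prefixes : List (Family m n)
  prefixes = families n m

  suffixes : List (Family (k + t) n)
  suffixes = families n (k + t)

  ∑-tuples : (f : Family n n → ℕ) → ∑ (allTuples n) f ≡ ∑[ P ∈ prefixes ] ∑[ R ∈ suffixes ] f (join P R)
  ∑-tuples f = trans (∑-allVecs-subst (allVectors n) split f) (∑-allVecs-+ (allVectors n) m (k + t) _)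

  prefix-bound : ∀ b₁ → IsBasis b₁ → (P : Family m n) (h : Bool) →
    αN * ∑[ R ∈ suffixes ] 𝟙 (linIndepᵇ (P ++ᵛ R) ∧ h)
      ≤ αD * ∑[ R ∈ suffixes ] 𝟙 (linIndepᵇ (P ++ᵛ R) ∧ (h ∧ linIndepᵇ (rest b₁ ++ᵛ Vec.take k R)))
  prefix-bound b₁ basis P false = ≤-trans (≤-reflexive (trans
    (cong (αN *_) (∑-zero suffixes (λ R → cong 𝟙 (∧-zeroʳ (linIndepᵇ (P ++ᵛ R)))))) (*-zeroʳ αN))) z≤n
  prefix-bound b₁ basis P true with linIndep? P
  ... | yes indP = ≤-trans (≤-reflexive (cong (αN *_) (∑-cong suffixes (λ R → cong 𝟙 (∧-identityʳ (linIndepᵇ (P ++ᵛ R)))))))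
                           (alpha-extensions-bound k t P (rest b₁) u+k≡n indP (linIndep-rest b₁ basis))
  ... | no depP  = ≤-trans (≤-reflexive (trans (cong (αN *_) (trans
    (∑-cong suffixes (λ R → cong 𝟙 (∧-identityʳ (linIndepᵇ (P ++ᵛ R))))) (extensions-dependent P (k + t) depP))) (*-zeroʳ αN))) z≤n

  R₀ : Family (k + t) n
  R₀ = Vec.replicate (k + t) zeroV

  given : Pair n → Bool
  given ω = bothBases ω ∧ agrees k y ω

  given∧Yᵢ : Pair n → Bool
  given∧Yᵢ ω = bothBases ω ∧ agrees k y ω ∧ Y k (suc i′) ω

  basis-bound : ∀ b₁ → IsBasis b₁ → αN * ∑[ b₂ ∈ allTuples n ] 𝟙 (given (b₁ , b₂))
                                  ≤ αD * ∑[ b₂ ∈ allTuples n ] 𝟙 (given∧Yᵢ (b₁ , b₂))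
  basis-bound b₁ basis = begin
    αN * ∑[ b₂ ∈ allTuples n ] 𝟙 (given (b₁ , b₂))
      ≡⟨ cong (αN *_) (trans (∑-tuples _) (∑-cong prefixes (λ P → ∑-cong suffixes (λ R → cong 𝟙 (given-join P R))))) ⟩
    αN * ∑[ P ∈ prefixes ] ∑[ R ∈ suffixes ] 𝟙 (linIndepᵇ (P ++ᵛ R) ∧ history P)
      ≡⟨ ∑-*ˡ prefixes αN _ ⟨
    ∑[ P ∈ prefixes ] (αN * ∑[ R ∈ suffixes ] 𝟙 (linIndepᵇ (P ++ᵛ R) ∧ history P))
      ≤⟨ ∑-mono prefixes (λ P → prefix-bound b₁ basis P (history P)) ⟩
    ∑[ P ∈ prefixes ] (αD * ∑[ R ∈ suffixes ] 𝟙 (linIndepᵇ (P ++ᵛ R) ∧ (history P ∧ linIndepᵇ (rest b₁ ++ᵛ Vec.take k R))))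
      ≡⟨ ∑-*ˡ prefixes αD _ ⟩
    αD * ∑[ P ∈ prefixes ] ∑[ R ∈ suffixes ] 𝟙 (linIndepᵇ (P ++ᵛ R) ∧ (history P ∧ linIndepᵇ (rest b₁ ++ᵛ Vec.take k R)))
      ≡⟨ cong (αD *_) (trans (∑-tuples _) (∑-cong prefixes (λ P → ∑-cong suffixes (λ R → cong 𝟙 (given∧Y-join P R))))) ⟨
    αD * ∑[ b₂ ∈ allTuples n ] 𝟙 (given∧Yᵢ (b₁ , b₂)) ∎
    where
    open ≤-Reasoning
    history : Family m n → Bool
    history P = agrees k y (b₁ , join P R₀)
    bothBases-join : ∀ P R → bothBases (b₁ , join P R) ≡ linIndepᵇ (P ++ᵛ R)
    bothBases-join P R = trans (cong (_∧ isBasisᵇ (join P R)) (⌊⌋-yes (isBasis? b₁) basis))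
                               (trans (isBasisᵇ≡linIndepᵇ (join P R)) (linIndepᵇ-subst split (P ++ᵛ R)))
    given-join : ∀ P R → given (b₁ , join P R) ≡ linIndepᵇ (P ++ᵛ R) ∧ history P
    given-join P R = cong₂ _∧_ (bothBases-join P R) (agrees-join b₁ P R R₀)
    given∧Y-join : ∀ P R → given∧Yᵢ (b₁ , join P R)
                         ≡ linIndepᵇ (P ++ᵛ R) ∧ (history P ∧ linIndepᵇ (rest b₁ ++ᵛ Vec.take k R))
    given∧Y-join P R = cong₂ _∧_ (bothBases-join P R) (cong₂ _∧_ (agrees-join b₁ P R R₀) (Y-join b₁ P R))

  row-bound : ∀ b₁ → αN * ∑[ b₂ ∈ allTuples n ] 𝟙 (given (b₁ , b₂))
                   ≤ αD * ∑[ b₂ ∈ allTuples n ] 𝟙 (given∧Yᵢ (b₁ , b₂))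
  row-bound b₁ = by-cases (isBasis? b₁)
    where
    by-cases : Dec (IsBasis b₁) → αN * ∑[ b₂ ∈ allTuples n ] 𝟙 (given (b₁ , b₂))
                                  ≤ αD * ∑[ b₂ ∈ allTuples n ] 𝟙 (given∧Yᵢ (b₁ , b₂))
    by-cases (yes basis) = basis-bound b₁ basis
    by-cases (no ¬basis) = ≤-trans (≤-reflexive (trans (cong (αN *_) (∑-zero (allTuples n) no-row)) (*-zeroʳ αN))) z≤n
      where
      no-row : ∀ b₂ → 𝟙 (given (b₁ , b₂)) ≡ 0
      no-row b₂ = cong (λ b → 𝟙 ((b ∧ isBasisᵇ b₂) ∧ agrees k y (b₁ , b₂))) (⌊⌋-no (isBasis? b₁) ¬basis)

  count-allPairs : (p : Pair n → Bool) → count p (allPairs n) ≡ ∑[ b₁ ∈ allTuples n ] ∑[ b₂ ∈ allTuples n ] 𝟙 (p (b₁ , b₂))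
  count-allPairs p = trans (count≡∑𝟙 p (allPairs n)) (trans (∑-concatMap _ (allTuples n) _)
    (∑-cong (allTuples n) (λ b₁ → ∑-map (b₁ ,_) (allTuples n) _)))

  conditional-bound : αN * count given (allPairs n) ≤ αD * count given∧Yᵢ (allPairs n)
  conditional-bound = begin
    αN * count given (allPairs n)                                       ≡⟨ cong (αN *_) (count-allPairs _) ⟩
    αN * ∑[ b₁ ∈ allTuples n ] ∑[ b₂ ∈ allTuples n ] 𝟙 (given (b₁ , b₂))  ≡⟨ ∑-*ˡ (allTuples n) αN _ ⟨
    ∑[ b₁ ∈ allTuples n ] (αN * ∑[ b₂ ∈ allTuples n ] 𝟙 (given (b₁ , b₂)))  ≤⟨ ∑-mono (allTuples n) row-bound ⟩
    ∑[ b₁ ∈ allTuples n ] (αD * ∑[ b₂ ∈ allTuples n ] 𝟙 (given∧Yᵢ (b₁ , b₂)))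
      ≡⟨ ∑-*ˡ (allTuples n) αD _ ⟩
    αD * ∑[ b₁ ∈ allTuples n ] ∑[ b₂ ∈ allTuples n ] 𝟙 (given∧Yᵢ (b₁ , b₂))
      ≡⟨ cong (αD *_) (count-allPairs _) ⟨
    αD * count given∧Yᵢ (allPairs n)             ∎
    where open ≤-Reasoning

lemma3 : (q : ℕ) → IsPrimePower q → (F : FiniteField q) →
    (n : ℕ) → 1 ≤ n → (k : ℕ) → .{{_ : NonZero k}} → LeLn k n →
    (i : ℕ) → 1 ≤ i → i ≤ n / k → (y : Vec Bool (i ∸ 1)) →
    let open LinAlg F in
    alphaNum q k * count (λ ω → bothBases ω ∧ agrees k y ω) (allPairs n)
    ≤ alphaDen q k * count (λ ω → bothBases ω ∧ agrees k y ω ∧ Y k i ω) (allPairs n)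
lemma3 q _ F n _ k _ (suc i′) _ i≤n/k y =
  Experiment.conditional-bound F n k i′ y (≤-trans (*-monoˡ-≤ k i≤n/k) (m/n*n≤m n k))
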